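{- Let $S=\{R_0,\ldots,R_d\}$ be an association scheme on a nonempty finite set $X$, $\mathbb{F}$ a field, and $x\in X$. Let $\mathcal{T}_0$ be the $\mathbb{F}$-linear span of all matrices $E_i^*A_jE_\ell^*$ with $i,j,\ell\in\{0,\ldots,d\}$. If $\mathcal{T}_0$ is a unital $\mathbb{F}$-subalgebra of $M_X(\mathbb{F})$, then $S$ has no bad pair.
   Context: An association scheme on $X$ is a partition $S=\{R_0,\ldots,R_d\}$ of $X\times X$ into nonempty relations with $R_0$ the diagonal, closed under transposes ($R_{c'}$ the transpose of $R_c$), with $p_{ij}^k=|\{\ell:(m,\ell)\in R_i,(\ell,n)\in R_j\}|$ independent of $(m,n)\in R_k$. Valency $k_a=|xR_a|$, $xR_a=\{z:(x,z)\in R_a\}$; $R_aR_b=\{R_c:p_{ab}^c>0\}$. $A_j\in M_X(\mathbb{F})$ is the $(0,1)$ adjacency matrix of $R_j$, $E_i^*$ the diagonal $(0,1)$-matrix with $(m,m)$-entry $1$ iff $m\in xR_i$. A pair $(u,v)$ is a bad pair of $S$ if there exist an integer $a\ge1$ and indices $i_b,j_b,\ell_b$ ($b=0,\ldots,a$) with $i_0=u$, $\ell_a=v$, $k_{i_b}=k_{\ell_b}=2$, $p_{i_bj_b}^{\ell_b}=1$ for all $b$, $\ell_c=i_{c+1}$ for $c=0,\ldots,a-1$, and $|R_{i_0'}R_{\ell_a}|=1$. -}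

module Defs where

open import Level using (Level; _⊔_)
open import Data.Nat as ℕ using (ℕ; zero; suc; _≥_; _>_)
open import Data.Bool using (Bool; true; false; _∧_)
open import Data.Fin using (Fin; zero; suc; fromℕ; inject₁; _≟_)
open import Data.Product using (Σ; ∃; _×_; _,_)
open import Relation.Nullary using (¬_)
open import Relation.Nullary.Decidable using (⌊_⌋)
open import Relation.Binary.PropositionalEquality using (_≡_)
open import Algebra.Bundles using (CommutativeRing)

record Field (c ℓ : Level) : Set (Level.suc (c ⊔ ℓ)) where
  field
    commutativeRing : CommutativeRing c ℓ
  open CommutativeRing commutativeRing public
  field
    0≉1     : ¬ (0# ≈ 1#)
    inverse : ∀ x → ¬ (x ≈ 0#) → Σ Carrier (λ y → (x * y) ≈ 1#)

count : ∀ {n} → (Fin n → Bool) → ℕ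
count {zero}  P = 0
count {suc n} P with P zero
... | true  = suc (count (λ i → P (suc i)))
... | false = count (λ i → P (suc i))

-- Association schemes.  X = Fin n, relations indexed by Fin (suc d);
-- rel m n = i  means  (m , n) ∈ R_i.

record AssocScheme (n d : ℕ) : Set where
  field
    rel       : Fin n → Fin n → Fin (suc d)
    nonempty  : ∀ i → Σ (Fin n) (λ m → Σ (Fin n) (λ m' → rel m m' ≡ i))
    diag      : ∀ m m' → (rel m m' ≡ zero → m ≡ m') × (m ≡ m' → rel m m' ≡ zero)
    tr        : Fin (suc d) → Fin (suc d)
    tr-spec   : ∀ m m' → rel m' m ≡ tr (rel m m')
    p         : Fin (suc d) → Fin (suc d) → Fin (suc d) → ℕ
    p-spec    : ∀ i j m m' →
                count (λ l → ⌊ rel m l ≟ i ⌋ ∧ ⌊ rel l m' ≟ j ⌋) ≡ p i j (rel m m')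

module _ {n d : ℕ} (S : AssocScheme n d) where
  open AssocScheme S

  -- valency k_a = |x R_a| (computed at the base point x; independent of x)
  valency : Fin n → Fin (suc d) → ℕ
  valency x a = count (λ z → ⌊ rel x z ≟ a ⌋)

  -- |R_a R_b| = number of c with p_{ab}^c > 0
  prodSize : Fin (suc d) → Fin (suc d) → ℕ
  prodSize a b = count (λ c → ⌊ 1 ℕ.≤? p a b c ⌋)

  BadPair : Fin n → Fin (suc d) → Fin (suc d) → Set
  BadPair x u v =
    Σ ℕ λ a → (a ≥ 1) ×
    Σ (Fin (suc a) → Fin (suc d)) λ i →
    Σ (Fin (suc a) → Fin (suc d)) λ j →
    Σ (Fin (suc a) → Fin (suc d)) λ l →
      (i zero ≡ u) × (l (fromℕ a) ≡ v)
      × (∀ b → valency x (i b) ≡ 2)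
      × (∀ b → valency x (l b) ≡ 2)
      × (∀ b → p (i b) (j b) (l b) ≡ 1)
      × (∀ (c : Fin a) → l (inject₁ c) ≡ i (suc c))
      × (prodSize (tr (i zero)) (l (fromℕ a)) ≡ 1)

module Matrices {c ℓ : Level} (F : Field c ℓ) where
  open Field F using (Carrier; _≈_; _+_; _*_; 0#; 1#)

  Mat : ℕ → Set c
  Mat n = Fin n → Fin n → Carrier

  ∑ : ∀ {k} → (Fin k → Carrier) → Carrier
  ∑ {zero}  f = 0#
  ∑ {suc k} f = f zero + ∑ (λ i → f (suc i))

  _≋_ : ∀ {n} → Mat n → Mat n → Set ℓ
  M ≋ N = ∀ a b → M a b ≈ N a b

  _⊗_ : ∀ {n} → Mat n → Mat n → Mat n
  (M ⊗ N) a b = ∑ (λ k → M a k * N k b)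

  _·_ : ∀ {n} → Carrier → Mat n → Mat n
  (s · M) a b = s * M a b

  _⊕_ : ∀ {n} → Mat n → Mat n → Mat n
  (M ⊕ N) a b = M a b + N a b

  zeroM : ∀ {n} → Mat n
  zeroM a b = 0#

  δ : Bool → Carrier
  δ true  = 1#
  δ false = 0#

  idM : ∀ {n} → Mat n
  idM a b = δ ⌊ a ≟ b ⌋

  module _ {n d : ℕ} (S : AssocScheme n d) (x : Fin n) where
    open AssocScheme S

    A : Fin (suc d) → Mat n
    A j a b = δ ⌊ rel a b ≟ j ⌋

    E* : Fin (suc d) → Mat n
    E* i a b = δ (⌊ a ≟ b ⌋ ∧ ⌊ rel x a ≟ i ⌋)

    InT₀ : Mat n → Set (c ⊔ ℓ)
    InT₀ M = Σ (Fin (suc d) → Fin (suc d) → Fin (suc d) → Carrier) λ coef →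
      M ≋ (λ a b → ∑ λ i → ∑ λ j → ∑ λ l →
              (coef i j l · ((E* i ⊗ A j) ⊗ E* l)) a b)

    -- T_0 is a unital F-subalgebra of M_X(F): a subspace (automatic for a
    -- span, stated anyway) containing the identity, closed under products.
    IsUnitalSubalgebra : Set (c ⊔ ℓ)
    IsUnitalSubalgebra =
        InT₀ zeroM
      × (∀ M N → InT₀ M → InT₀ N → InT₀ (M ⊕ N))
      × (∀ s M → InT₀ M → InT₀ (s · M))
      × InT₀ idM
      × (∀ M N → InT₀ M → InT₀ N → InT₀ (M ⊗ N))

-- Every matrix of T₀ has an (a, b)-entry that depends only on the triple
-- (rel x a, rel a b, rel x b).  When p_{ij}^l = 1, each column h ∈ xR_l of
-- E*_i A_j E*_l is a unit vector e_g with g ∈ xR_i.  Multiplying these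
-- generators along a bad-pair chain (closure under products) gives N ∈ T₀
-- whose column w ∈ xR_v is e_h with h ∈ xR_u.  As k_u = 2 there is z ≠ h in
-- xR_u, and |R_{u'} R_v| = 1 forces rel z w = rel h w; hence N z w = N h w,
-- that is 0 = 1.

module Submission where

open import Defs
open import Level using (Level; _⊔_)
open import Data.Nat using (ℕ; zero; suc; _≤_; z≤n; s≤s; _≤?_)
open import Data.Nat.Properties using (≤-trans; ≤-pred; ≤-reflexive)
open import Data.Fin using (Fin; zero; suc; fromℕ; inject₁; _≟_)
open import Data.Fin.Properties using (suc-injective)
open import Data.Bool using (Bool; true; false; T; _∧_)
open import Data.Bool.Properties using (T-∧)
open import Data.Product using (∃; _×_; _,_; proj₁; proj₂)
open import Data.Product.Properties using (≡-dec)
open import Function using (_∘_; Equivalence)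
open import Relation.Nullary using (Dec; ¬_; yes; no; contradiction)
open import Relation.Nullary.Decidable using (⌊_⌋; toWitness; fromWitness)
open import Relation.Binary.PropositionalEquality as ≡ using (_≡_; _≢_; refl; cong)

T⇒1≤count : ∀ {n} (Q : Fin n → Bool) a → T (Q a) → 1 ≤ count Q
T⇒1≤count Q zero Qa with Q zero
... | true = s≤s z≤n
T⇒1≤count Q (suc a) Qa with Q zero
... | true  = s≤s z≤n
... | false = T⇒1≤count (Q ∘ suc) a Qa

1≤count⇒∃ : ∀ {n} (Q : Fin n → Bool) → 1 ≤ count Q → ∃ λ a → T (Q a)
1≤count⇒∃ {suc n} Q h with Q zero in eq
... | true  = zero , ≡.subst T (≡.sym eq) _
... | false = let a , Qa = 1≤count⇒∃ (Q ∘ suc) h in suc a , Qa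

≢⇒2≤count : ∀ {n} (Q : Fin n → Bool) {a b} → a ≢ b → T (Q a) → T (Q b) → 2 ≤ count Q
≢⇒2≤count Q {zero}  {zero}  a≢b _ _ = contradiction refl a≢b
≢⇒2≤count Q {zero}  {suc b} _ Qa Qb with Q zero
... | true = s≤s (T⇒1≤count (Q ∘ suc) b Qb)
≢⇒2≤count Q {suc a} {zero}  _ Qa Qb with Q zero
... | true = s≤s (T⇒1≤count (Q ∘ suc) a Qa)
≢⇒2≤count Q {suc a} {suc b} a≢b Qa Qb with Q zero
... | true  = s≤s (T⇒1≤count (Q ∘ suc) a Qa)
... | false = ≢⇒2≤count (Q ∘ suc) (a≢b ∘ cong suc) Qa Qb

2≤count⇒∃≢ : ∀ {n} (Q : Fin n → Bool) → 2 ≤ count Q → ∀ b → ∃ λ a → a ≢ b × T (Q a)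
2≤count⇒∃≢ {suc n} Q h zero with Q zero
... | true  = let a , Qa = 1≤count⇒∃ (Q ∘ suc) (≤-pred h) in suc a , (λ ()) , Qa
... | false = let a , Qa = 1≤count⇒∃ (Q ∘ suc) (≤-trans (s≤s z≤n) h) in suc a , (λ ()) , Qa
2≤count⇒∃≢ {suc n} Q h (suc b) with Q zero in eq
... | true  = zero , (λ ()) , ≡.subst T (≡.sym eq) _
... | false = let a , a≢b , Qa = 2≤count⇒∃≢ (Q ∘ suc) h b in suc a , a≢b ∘ suc-injective , Qa

count≡1⇒≡ : ∀ {n} (Q : Fin n → Bool) → count Q ≡ 1 → ∀ {a b} → T (Q a) → T (Q b) → a ≡ b
count≡1⇒≡ Q count≡1 {a} {b} Qa Qb with a ≟ b
... | yes a≡b = a≡b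
... | no a≢b  = contradiction (≡.subst (2 ≤_) count≡1 (≢⇒2≤count Q a≢b Qa Qb)) λ { (s≤s ()) }

module _ {n d : ℕ} (S : AssocScheme n d) where
  open AssocScheme S

  prodSize≡1⇒rel-determined : ∀ {i l y h z w} → prodSize S (tr i) l ≡ 1 →
    rel y h ≡ i → rel y z ≡ i → rel y w ≡ l → rel h w ≡ rel z w
  prodSize≡1⇒rel-determined {i} {l} {y} {w = w} size≡1 yh yz yw =
    count≡1⇒≡ (λ c → ⌊ 1 ≤? p (tr i) l c ⌋) size≡1 (rel∈product yh) (rel∈product yz)
    where
    rel∈product : ∀ {t} → rel y t ≡ i → T ⌊ 1 ≤? p (tr i) l (rel t w) ⌋
    rel∈product {t} yt = fromWitness (≡.subst (1 ≤_) (p-spec (tr i) l t w)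
      (T⇒1≤count _ y (Equivalence.from (T-∧ {⌊ rel t y ≟ tr i ⌋})
        (fromWitness (≡.trans (tr-spec y t) (cong tr yt)) , fromWitness yw))))

module _ {c ℓ : Level} (F : Field c ℓ) where
  open Field F hiding (zero) renaming (refl to ≈-refl)
  open Matrices F
  open import Relation.Binary.Reasoning.Setoid setoid

  ∑-cong : ∀ {k} {f g : Fin k → Carrier} → (∀ i → f i ≈ g i) → ∑ f ≈ ∑ g
  ∑-cong {zero}  f≈g = ≈-refl
  ∑-cong {suc k} f≈g = +-cong (f≈g zero) (∑-cong (f≈g ∘ suc))

  ∑-zero : ∀ {k} (f : Fin k → Carrier) → (∀ i → f i ≈ 0#) → ∑ f ≈ 0#
  ∑-zero {zero}  f f≈0 = ≈-refl
  ∑-zero {suc k} f f≈0 = trans (+-cong (f≈0 zero) (∑-zero (f ∘ suc) (f≈0 ∘ suc))) (+-identityʳ 0#)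

  ∑-delta : ∀ {k} (f : Fin k → Carrier) a → (∀ i → i ≢ a → f i ≈ 0#) → ∑ f ≈ f a
  ∑-delta {suc k} f zero f≈0 =
    trans (+-cong ≈-refl (∑-zero (f ∘ suc) (λ i → f≈0 (suc i) λ ()))) (+-identityʳ (f zero))
  ∑-delta {suc k} f (suc a) f≈0 =
    trans (+-cong (f≈0 zero λ ()) (∑-delta (f ∘ suc) a (λ i i≢a → f≈0 (suc i) (i≢a ∘ suc-injective))))
          (+-identityˡ (f (suc a)))

  δ-yes : ∀ {a} {A : Set a} (a? : Dec A) → A → δ ⌊ a? ⌋ ≡ 1#
  δ-yes (yes _) _ = ≡.refl
  δ-yes (no ¬a) a = contradiction a ¬a

  δ-no : ∀ {a} {A : Set a} (a? : Dec A) → ¬ A → δ ⌊ a? ⌋ ≡ 0#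
  δ-no (yes a) ¬a = contradiction a ¬a
  δ-no (no _)  _  = ≡.refl

  ∑³-delta : ∀ {k k′ k″} (f : Fin k → Fin k′ → Fin k″ → Carrier) i₀ j₀ l₀ →
    (∀ i j l → (i , j , l) ≢ (i₀ , j₀ , l₀) → f i j l ≈ 0#) →
    (∑ λ i → ∑ λ j → ∑ λ l → f i j l) ≈ f i₀ j₀ l₀
  ∑³-delta f i₀ j₀ l₀ f≈0 = begin
    (∑ λ i → ∑ λ j → ∑ λ l → f i j l)  ≈⟨ ∑-delta _ i₀ (λ i i≢ → ∑-zero _ λ j → ∑-zero _ λ l →
                                            f≈0 i j l (i≢ ∘ cong proj₁)) ⟩
    (∑ λ j → ∑ λ l → f i₀ j l)          ≈⟨ ∑-delta _ j₀ (λ j j≢ → ∑-zero _ λ l →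
                                            f≈0 i₀ j l (j≢ ∘ cong (proj₁ ∘ proj₂))) ⟩
    (∑ λ l → f i₀ j₀ l)                 ≈⟨ ∑-delta _ l₀ (λ l l≢ →
                                            f≈0 i₀ j₀ l (l≢ ∘ cong (proj₂ ∘ proj₂))) ⟩
    f i₀ j₀ l₀                          ∎

  module _ {m : ℕ} (M N : Mat m) (z w : Fin m) where

    ⊗-supportˡ : ∀ h → (∀ k → k ≢ h → M z k ≈ 0#) → (M ⊗ N) z w ≈ M z h * N h w
    ⊗-supportˡ h M≈0 = ∑-delta _ h λ k k≢h → trans (*-congʳ (M≈0 k k≢h)) (zeroˡ (N k w))

    ⊗-supportʳ : ∀ h → (∀ k → k ≢ h → N k w ≈ 0#) → (M ⊗ N) z w ≈ M z h * N h w
    ⊗-supportʳ h N≈0 = ∑-delta _ h λ k k≢h → trans (*-congˡ (N≈0 k k≢h)) (zeroʳ (M z k))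

  UnitColumn : ∀ {m} → Mat m → Fin m → Fin m → Set ℓ
  UnitColumn N w h = ∀ z → N z w ≈ δ ⌊ z ≟ h ⌋

  UnitColumn-⊗ : ∀ {m} {M N : Mat m} {w h g} → UnitColumn N w h → UnitColumn M h g → UnitColumn (M ⊗ N) w g
  UnitColumn-⊗ {M = M} {N} {w} {h} {g} Nw Mh z = begin
    (M ⊗ N) z w    ≈⟨ ⊗-supportʳ M N z w h (λ k k≢h → trans (Nw k) (reflexive (δ-no (k ≟ h) k≢h))) ⟩
    M z h * N h w  ≈⟨ *-congˡ (trans (Nw h) (reflexive (δ-yes (h ≟ h) ≡.refl))) ⟩
    M z h * 1#     ≈⟨ *-identityʳ (M z h) ⟩
    M z h          ≈⟨ Mh z ⟩
    δ ⌊ z ≟ g ⌋    ∎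

  module _ {n d : ℕ} (S : AssocScheme n d) (x : Fin n) where
    open AssocScheme S

    Triple : Set
    Triple = Fin (suc d) × Fin (suc d) × Fin (suc d)

    _≟³_ : (t t′ : Triple) → Dec (t ≡ t′)
    _≟³_ = ≡-dec _≟_ (≡-dec _≟_ _≟_)

    relTriple : Fin n → Fin n → Triple
    relTriple a b = rel x a , rel a b , rel x b

    generator : Fin (suc d) → Fin (suc d) → Fin (suc d) → Mat n
    generator i j l = (E* S x i ⊗ A S x j) ⊗ E* S x l

    E*-off-diagonal : ∀ i {a b} → a ≢ b → E* S x i a b ≈ 0#
    E*-off-diagonal i {a} {b} a≢b with a ≟ b
    ... | yes a≡b = contradiction a≡b a≢b
    ... | no _    = ≈-refl

    E*-on-diagonal : ∀ i a → E* S x i a a ≈ δ ⌊ rel x a ≟ i ⌋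
    E*-on-diagonal i a with a ≟ a
    ... | yes _   = ≈-refl
    ... | no a≢a  = contradiction ≡.refl a≢a

    δ-product-≢ : ∀ {s t u i j l : Fin (suc d)} → (s , t , u) ≢ (i , j , l) →
      (δ ⌊ s ≟ i ⌋ * δ ⌊ t ≟ j ⌋) * δ ⌊ u ≟ l ⌋ ≈ 0#
    δ-product-≢ {s} {t} {u} {i} {j} {l} stu≢ijl with s ≟ i | t ≟ j | u ≟ l
    ... | yes ≡.refl | yes ≡.refl | yes ≡.refl = contradiction ≡.refl stu≢ijl
    ... | no _  | _     | _    = trans (*-congʳ (zeroˡ _)) (zeroˡ _)
    ... | yes _ | no _  | _    = trans (*-congʳ (zeroʳ _)) (zeroˡ _)
    ... | yes _ | yes _ | no _ = zeroʳ _

    δ-≟³ : ∀ (s t u i j l : Fin (suc d)) →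
      (δ ⌊ s ≟ i ⌋ * δ ⌊ t ≟ j ⌋) * δ ⌊ u ≟ l ⌋ ≈ δ ⌊ (s , t , u) ≟³ (i , j , l) ⌋
    δ-≟³ s t u i j l with (s , t , u) ≟³ (i , j , l)
    ... | yes ≡.refl = begin
      (δ ⌊ s ≟ s ⌋ * δ ⌊ t ≟ t ⌋) * δ ⌊ u ≟ u ⌋
        ≡⟨ ≡.cong₂ _*_ (≡.cong₂ _*_ (δ-yes (s ≟ s) ≡.refl) (δ-yes (t ≟ t) ≡.refl))
                       (δ-yes (u ≟ u) ≡.refl) ⟩
      (1# * 1#) * 1#
        ≈⟨ trans (*-identityʳ _) (*-identityʳ 1#) ⟩
      1#
        ∎
    ... | no stu≢ijl = δ-product-≢ stu≢ijl

    generator-entry : ∀ i j l a b → generator i j l a b ≈ δ ⌊ relTriple a b ≟³ (i , j , l) ⌋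
    generator-entry i j l a b = begin
      generator i j l a b
        ≈⟨ ⊗-supportʳ (E* S x i ⊗ A S x j) (E* S x l) a b b (λ k k≢b → E*-off-diagonal l k≢b) ⟩
      (E* S x i ⊗ A S x j) a b * E* S x l b b
        ≈⟨ *-cong (⊗-supportˡ (E* S x i) (A S x j) a b a (λ k k≢a → E*-off-diagonal i (k≢a ∘ ≡.sym)))
                  (E*-on-diagonal l b) ⟩
      (E* S x i a a * A S x j a b) * δ ⌊ rel x b ≟ l ⌋
        ≈⟨ *-congʳ (*-congʳ (E*-on-diagonal i a)) ⟩
      (δ ⌊ rel x a ≟ i ⌋ * δ ⌊ rel a b ≟ j ⌋) * δ ⌊ rel x b ≟ l ⌋
        ≈⟨ δ-≟³ (rel x a) (rel a b) (rel x b) i j l ⟩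
      δ ⌊ relTriple a b ≟³ (i , j , l) ⌋
        ∎

    generator∈T₀ : ∀ i j l → InT₀ S x (generator i j l)
    generator∈T₀ i₀ j₀ l₀ = coefficient , λ a b → sym (begin
      (∑ λ i → ∑ λ j → ∑ λ l → coefficient i j l * generator i j l a b)
        ≈⟨ ∑³-delta (λ i j l → coefficient i j l * generator i j l a b) i₀ j₀ l₀ (λ i j l t≢t₀ →
             trans (*-congʳ (reflexive (δ-no ((i , j , l) ≟³ (i₀ , j₀ , l₀)) t≢t₀))) (zeroˡ _)) ⟩
      coefficient i₀ j₀ l₀ * generator i₀ j₀ l₀ a b
        ≈⟨ *-congʳ (reflexive (δ-yes ((i₀ , j₀ , l₀) ≟³ (i₀ , j₀ , l₀)) ≡.refl)) ⟩
      1# * generator i₀ j₀ l₀ a b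
        ≈⟨ *-identityˡ _ ⟩
      generator i₀ j₀ l₀ a b
        ∎)
      where
      coefficient : Fin (suc d) → Fin (suc d) → Fin (suc d) → Carrier
      coefficient i j l = δ ⌊ (i , j , l) ≟³ (i₀ , j₀ , l₀) ⌋

    generator-entry-invariant : ∀ i j l {a b a′ b′} → relTriple a b ≡ relTriple a′ b′ →
      generator i j l a b ≈ generator i j l a′ b′
    generator-entry-invariant i j l {a} {b} {a′} {b′} same = begin
      generator i j l a b                   ≈⟨ generator-entry i j l a b ⟩
      δ ⌊ relTriple a b ≟³ (i , j , l) ⌋    ≡⟨ cong (λ t → δ ⌊ t ≟³ (i , j , l) ⌋) same ⟩
      δ ⌊ relTriple a′ b′ ≟³ (i , j , l) ⌋  ≈⟨ generator-entry i j l a′ b′ ⟨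
      generator i j l a′ b′                 ∎

    T₀-entry-invariant : ∀ {M a b a′ b′} → InT₀ S x M → relTriple a b ≡ relTriple a′ b′ →
      M a b ≈ M a′ b′
    T₀-entry-invariant {M} {a} {b} {a′} {b′} (coefficient , M≋) same = begin
      M a b
        ≈⟨ M≋ a b ⟩
      (∑ λ i → ∑ λ j → ∑ λ l → coefficient i j l * generator i j l a b)
        ≈⟨ (∑-cong λ i → ∑-cong λ j → ∑-cong λ l →
             *-congˡ {coefficient i j l} (generator-entry-invariant i j l same)) ⟩
      (∑ λ i → ∑ λ j → ∑ λ l → coefficient i j l * generator i j l a′ b′)
        ≈⟨ sym (M≋ a′ b′) ⟩
      M a′ b′
        ∎

    generator-unitColumn : ∀ {i j l h} → p i j l ≡ 1 → rel x h ≡ l →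
      ∃ λ g → rel x g ≡ i × UnitColumn (generator i j l) h g
    generator-unitColumn {i} {j} {l} {h} p≡1 xh = g , xg , column
      where
      Q : Fin n → Bool
      Q k = ⌊ rel x k ≟ i ⌋ ∧ ⌊ rel k h ≟ j ⌋

      count≡1 : count Q ≡ 1
      count≡1 = ≡.trans (p-spec i j x h) (≡.trans (cong (p i j) xh) p≡1)

      witness : ∃ λ g → T (Q g)
      witness = 1≤count⇒∃ Q (≤-reflexive (≡.sym count≡1))

      g : Fin n
      g = proj₁ witness

      xg : rel x g ≡ i
      xg = toWitness (proj₁ (Equivalence.to (T-∧ {⌊ rel x g ≟ i ⌋}) (proj₂ witness)))

      gh : rel g h ≡ j
      gh = toWitness (proj₂ (Equivalence.to (T-∧ {⌊ rel x g ≟ i ⌋}) (proj₂ witness)))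

      column : UnitColumn (generator i j l) h g
      column z = trans (generator-entry i j l z h) (reflexive (entry≡δ z))
        where
        entry≡δ : ∀ z → δ ⌊ relTriple z h ≟³ (i , j , l) ⌋ ≡ δ ⌊ z ≟ g ⌋
        entry≡δ z with z ≟ g
        ... | yes ≡.refl = δ-yes (relTriple z h ≟³ (i , j , l)) (≡.cong₂ _,_ xg (≡.cong₂ _,_ gh xh))
        ... | no z≢g     = δ-no (relTriple z h ≟³ (i , j , l)) λ same →
          z≢g (count≡1⇒≡ Q count≡1
            (Equivalence.from (T-∧ {⌊ rel x z ≟ i ⌋})
              (fromWitness (cong proj₁ same) , fromWitness (cong (proj₁ ∘ proj₂) same)))
            (proj₂ witness))

    ⊗-Closed : Set (c ⊔ ℓ)
    ⊗-Closed = ∀ M N → InT₀ S x M → InT₀ S x N → InT₀ S x (M ⊗ N)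

    path-unitColumn : ⊗-Closed → ∀ a (i j l : Fin (suc a) → Fin (suc d)) →
      (∀ b → p (i b) (j b) (l b) ≡ 1) → (∀ c → l (inject₁ c) ≡ i (suc c)) →
      ∃ λ N → InT₀ S x N ×
        (∀ w → rel x w ≡ l (fromℕ a) → ∃ λ h → rel x h ≡ i zero × UnitColumn N w h)
    path-unitColumn closed zero i j l p≡1 _ =
      generator (i zero) (j zero) (l zero) , generator∈T₀ _ _ _ , λ w xw → generator-unitColumn (p≡1 zero) xw
    path-unitColumn closed (suc a) i j l p≡1 linked =
      let N , N∈T₀ , columns =
            path-unitColumn closed a (i ∘ suc) (j ∘ suc) (l ∘ suc) (p≡1 ∘ suc) (linked ∘ suc)
          G = generator (i zero) (j zero) (l zero)
      in G ⊗ N , closed G N (generator∈T₀ _ _ _) N∈T₀ , λ w xw →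
           let h , xh , Nw = columns w xw
               g , xg , Gh = generator-unitColumn (p≡1 zero) (≡.trans xh (≡.sym (linked zero)))
           in g , xg , UnitColumn-⊗ {M = G} {N} Nw Gh

    T₀-unitColumn-unique : ∀ {M w h z} → InT₀ S x M → UnitColumn M w h →
      rel x z ≡ rel x h → rel z w ≡ rel h w → z ≡ h
    T₀-unitColumn-unique {M} {w} {h} {z} M∈T₀ Mw xz zw with z ≟ h
    ... | yes z≡h = z≡h
    ... | no z≢h  = contradiction (begin
      0#           ≡⟨ δ-no (z ≟ h) z≢h ⟨
      δ ⌊ z ≟ h ⌋  ≈⟨ Mw z ⟨
      M z w        ≈⟨ T₀-entry-invariant M∈T₀ (≡.cong₂ _,_ xz (≡.cong₂ _,_ zw ≡.refl)) ⟩
      M h w        ≈⟨ Mw h ⟩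
      δ ⌊ h ≟ h ⌋  ≡⟨ δ-yes (h ≟ h) ≡.refl ⟩
      1#           ∎) 0≉1

lemma4p8 : ∀ {c ℓ : Level} (F : Field c ℓ) (n d : ℕ) (S : AssocScheme (suc n) d)
    (x : Fin (suc n)) →
    Matrices.IsUnitalSubalgebra F S x →
    ∀ (u v : Fin (suc d)) → ¬ BadPair S x u v
lemma4p8 F n d S x (_ , _ , _ , _ , closed) u v
         (a , _ , i , j , l , _ , _ , valency-i , valency-l , p≡1 , linked , size≡1) =
  let N , N∈T₀ , columns = path-unitColumn F S x closed a i j l p≡1 linked
      w , xw = 1≤count⇒∃ (λ z → ⌊ rel x z ≟ l (fromℕ a) ⌋)
                 (≤-trans (s≤s z≤n) (≤-reflexive (≡.sym (valency-l (fromℕ a)))))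
      h , xh , Nw = columns w (toWitness xw)
      z , z≢h , xz = 2≤count⇒∃≢ (λ z → ⌊ rel x z ≟ i zero ⌋) (≤-reflexive (≡.sym (valency-i zero))) h
      hw≡zw = prodSize≡1⇒rel-determined S size≡1 xh (toWitness xz) (toWitness xw)
  in z≢h (T₀-unitColumn-unique F S x N∈T₀ Nw (≡.trans (toWitness xz) (≡.sym xh)) (≡.sym hw≡zw))
  where open AssocScheme S using (rel)
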